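{- Let $p$ be a prime with $p\equiv1\pmod4$ and let $\{\mathcal F_n\},\{\mathcal L_n\}$ be as in the context. Then the period of $\{\mathcal F_n\}\bmod p^2$ divides $p^2(p-1)$, and the period of $\{\mathcal L_n\}\bmod p^2$ divides $p(p-1)$.
   Context: Let $u_p=(t+b\sqrt p)/2>1$, with $t,b$ positive integers, be the fundamental unit of $\mathbb Q(\sqrt p)$. Define sequences indexed by $n\in\mathbb Z$ by $\mathcal F_0=0,\ \mathcal F_1=1,\ \mathcal F_{n+2}=t\mathcal F_{n+1}+\mathcal F_n$ and $\mathcal L_0=2,\ \mathcal L_1=t,\ \mathcal L_{n+2}=t\mathcal L_{n+1}+\mathcal L_n$. -}

module Defs where

open import Data.Nat as ℕ using (ℕ; zero; suc)
open import Data.Nat.Primality using (Prime)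
open import Data.Integer as ℤ using (ℤ; +_; _+_; _-_; _*_; _<_; _≤_; -[1+_])
open import Data.Integer.Divisibility using (_∣_)
open import Data.Product using (_×_)
open import Data.Sum using (_⊎_)
open import Relation.Binary.PropositionalEquality using (_≡_)

-- u * √p < v  (for integers u v, and natural p), decided by signs and squaring.
SqrtLt : ℕ → ℤ → ℤ → Set
SqrtLt p u v =
    (+ 0 ≤ u × + 0 < v × (+ p) * u * u < v * v)
  ⊎ (u < + 0 × + 0 ≤ v)
  ⊎ (u < + 0 × v < + 0 × v * v < (+ p) * u * u)

-- (x + y√p)/2 is a unit of the ring of integers of Q(√p): norm x² - p y² = ±4.
IsUnit : ℕ → ℕ → ℕ → Set
IsUnit p x y =
  ((+ x) * (+ x) - (+ p) * (+ y) * (+ y) ≡ + 4)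
  ⊎ ((+ x) * (+ x) - (+ p) * (+ y) * (+ y) ≡ ℤ.- (+ 4))

-- (t + b√p)/2 > 1, with t b positive integers, is the fundamental unit of Q(√p):
-- it is a unit and no unit (x + y√p)/2 > 1 (x, y positive integers) is strictly smaller.
IsFundamentalUnit : ℕ → ℕ → ℕ → Set
IsFundamentalUnit p t b =
  (0 ℕ.< t) × (0 ℕ.< b) × IsUnit p t b ×
  (∀ x y → 0 ℕ.< x → 0 ℕ.< y → IsUnit p x y →
     -- not ( x + y√p < t + b√p ), i.e. not ( (y - b)√p < t - x )
     (SqrtLt p (+ y - + b) (+ t - + x) → Data.Empty.⊥))
  where import Data.Empty

𝓕 : ℤ → ℕ → ℤ
𝓕 t zero = + 0
𝓕 t (suc zero) = + 1
𝓕 t (suc (suc n)) = t * 𝓕 t (suc n) + 𝓕 t n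

𝓛 : ℤ → ℕ → ℤ
𝓛 t zero = + 2
𝓛 t (suc zero) = t
𝓛 t (suc (suc n)) = t * 𝓛 t (suc n) + 𝓛 t n

IsPeriodMod : ℕ → (ℕ → ℤ) → ℕ → Set
IsPeriodMod m f k = ∀ n → (+ m) ∣ (f (n ℕ.+ k) - f n)

IsLeastPeriodMod : ℕ → (ℕ → ℤ) → ℕ → Set
IsLeastPeriodMod m f k =
  (0 ℕ.< k) × IsPeriodMod m f k × (∀ j → 0 ℕ.< j → IsPeriodMod m f j → k ℕ.≤ j)

module Submission where

-- Since p ≡ 1 (mod 4) the fundamental unit has norm −1: a unit of norm +1 would give
-- (t − 2)(t + 2) = p b², and splitting this product into a square and p times a square
-- produces a smaller unit. Hence p ∣ D = t² + 4. Write (t + √D)ⁿ = Aₙ + Bₙ√D, so that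
-- 2ⁿ Lₙ = 2Aₙ and 2ⁿ Fₙ = 2Bₙ. As p ∣ D, the binomial expansion gives
-- Aₙ ≡ tⁿ + (n choose 2) tⁿ⁻² D (mod p²) and Bₙ ≡ n tⁿ⁻¹ (mod p). For K = p(p − 1),
-- Euler's theorem modulo p² gives t^K ≡ 2^K ≡ 1, hence A_K ≡ 1 (mod p²) and p ∣ B_K.
-- The addition formulas for (t + √D)^(m+n) then make A, and so L, K-periodic modulo p²,
-- and give B_{jK} ≡ j B_K, so that B, and so F, is pK-periodic. A least period divides
-- every period.

module Congruence where

  open import Data.Nat as ℕ using (ℕ; zero; suc; z≤n; s≤s)
  import Data.Nat.Properties as ℕ
  import Data.Nat.Divisibility as ℕ
  open import Data.Nat.DivMod using (_%_; _/_; m≡m%n+[m/n]*n; m%n<n)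
  open import Data.Integer as ℤ using (ℤ; _+_; _-_; _*_; _^_; -_; 0ℤ; 1ℤ; +_)
  import Data.Integer.Properties as ℤ
  open import Data.Integer.Divisibility.Signed
  open import Data.Integer.Tactic.RingSolver using (solve-∀)
  open import Data.Product using (_,_)
  open import Relation.Binary.Bundles using (Setoid)
  open import Relation.Binary.Structures using (IsEquivalence)
  open import Relation.Binary.PropositionalEquality using (_≡_; refl; sym; trans; cong; subst)
  open import Relation.Nullary using (contradiction)
  open import Defs using (IsPeriodMod; IsLeastPeriodMod)

  infix 4 _≡_[mod_]

  record _≡_[mod_] (x y m : ℤ) : Set where
    constructor mod∣
    field ∣-mod : m ∣ x - y

  open _≡_[mod_] public

  module _ {m : ℤ} where

    mod-reflexive : ∀ {x y} → x ≡ y → x ≡ y [mod m ]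
    mod-reflexive {x} refl = mod∣ (divides 0ℤ (ℤ.+-inverseʳ x))

    mod-refl : ∀ {x} → x ≡ x [mod m ]
    mod-refl = mod-reflexive refl

    mod-sym : ∀ {x y} → x ≡ y [mod m ] → y ≡ x [mod m ]
    mod-sym {x} {y} (mod∣ m∣x-y) = mod∣ (subst (m ∣_) (swap x y) (∣m⇒∣-m m∣x-y))
      where
      swap : ∀ x y → - (x - y) ≡ y - x
      swap = solve-∀

    mod-trans : ∀ {x y z} → x ≡ y [mod m ] → y ≡ z [mod m ] → x ≡ z [mod m ]
    mod-trans {x} {y} {z} (mod∣ m∣x-y) (mod∣ m∣y-z) =
      mod∣ (subst (m ∣_) (telescope x y z) (∣m∣n⇒∣m+n m∣x-y m∣y-z))
      where
      telescope : ∀ x y z → (x - y) + (y - z) ≡ x - z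
      telescope = solve-∀

    mod-isEquivalence : IsEquivalence _≡_[mod m ]
    mod-isEquivalence = record { refl = mod-refl ; sym = mod-sym ; trans = mod-trans }

    +-cong-mod : ∀ {a b c d} → a ≡ b [mod m ] → c ≡ d [mod m ] → a + c ≡ b + d [mod m ]
    +-cong-mod {a} {b} {c} {d} (mod∣ m∣a-b) (mod∣ m∣c-d) =
      mod∣ (subst (m ∣_) (regroup a b c d) (∣m∣n⇒∣m+n m∣a-b m∣c-d))
      where
      regroup : ∀ a b c d → (a - b) + (c - d) ≡ (a + c) - (b + d)
      regroup = solve-∀

    *-cong-mod : ∀ {a b c d} → a ≡ b [mod m ] → c ≡ d [mod m ] → a * c ≡ b * d [mod m ]
    *-cong-mod {a} {b} {c} {d} (mod∣ m∣a-b) (mod∣ m∣c-d) =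
      mod∣ (subst (m ∣_) (regroup a b c d) (∣m∣n⇒∣m+n (∣m⇒∣m*n c m∣a-b) (∣n⇒∣m*n b m∣c-d)))
      where
      regroup : ∀ a b c d → (a - b) * c + b * (c - d) ≡ a * c - b * d
      regroup = solve-∀

    +-congˡ-mod : ∀ a {c d} → c ≡ d [mod m ] → a + c ≡ a + d [mod m ]
    +-congˡ-mod a = +-cong-mod (mod-refl {a})

    *-congˡ-mod : ∀ a {c d} → c ≡ d [mod m ] → a * c ≡ a * d [mod m ]
    *-congˡ-mod a = *-cong-mod (mod-refl {a})

    ^-cong-mod : ∀ {a b} n → a ≡ b [mod m ] → a ^ n ≡ b ^ n [mod m ]
    ^-cong-mod zero    _   = mod-refl
    ^-cong-mod (suc n) a≡b = *-cong-mod a≡b (^-cong-mod n a≡b)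

    ∣⇒≡0-mod : ∀ {x} → m ∣ x → x ≡ 0ℤ [mod m ]
    ∣⇒≡0-mod {x} m∣x = mod∣ (subst (m ∣_) (sym (ℤ.+-identityʳ x)) m∣x)

    ≡0-mod⇒∣ : ∀ {x} → x ≡ 0ℤ [mod m ] → m ∣ x
    ≡0-mod⇒∣ {x} (mod∣ m∣x-0) = subst (m ∣_) (ℤ.+-identityʳ x) m∣x-0

  mod-setoid : ℤ → Setoid _ _
  mod-setoid m = record { isEquivalence = mod-isEquivalence {m} }

  *-∣-* : ∀ {a b c d} → a ∣ b → c ∣ d → a * c ∣ b * d
  *-∣-* {a} {c = c} (divides q refl) (divides r refl) = divides (q * r) (regroup q a r c)
    where
    regroup : ∀ q a r c → (q * a) * (r * c) ≡ (q * r) * (a * c)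
    regroup = solve-∀

  *-cong-mod-∣ : ∀ {q d x y} → q ∣ d → x ≡ y [mod q ] → d * x ≡ d * y [mod q * q ]
  *-cong-mod-∣ {q} {d} {x} {y} q∣d (mod∣ q∣x-y) =
    mod∣ (subst (q * q ∣_) (distrib d x y) (*-∣-* q∣d q∣x-y))
    where
    distrib : ∀ d x y → d * (x - y) ≡ d * x - d * y
    distrib = solve-∀

  *-cancelˡ-mod : ∀ {m c x y} K .{{_ : ℕ.NonZero K}} →
                  c ^ K ≡ 1ℤ [mod m ] → c * x ≡ c * y [mod m ] → x ≡ y [mod m ]
  *-cancelˡ-mod {m} {c} {x} {y} (suc k) cᵏ⁺¹≡1 cx≡cy = begin
    x                   ≡⟨ ℤ.*-identityˡ x ⟨
    1ℤ * x              ≈⟨ *-cong-mod (mod-sym cᵏ⁺¹≡1) mod-refl ⟩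
    c ^ suc k * x       ≡⟨ shift c (c ^ k) x ⟩
    c ^ k * (c * x)     ≈⟨ *-congˡ-mod (c ^ k) cx≡cy ⟩
    c ^ k * (c * y)     ≡⟨ shift c (c ^ k) y ⟨
    c ^ suc k * y       ≈⟨ *-cong-mod cᵏ⁺¹≡1 mod-refl ⟩
    1ℤ * y              ≡⟨ ℤ.*-identityˡ y ⟩
    y                   ∎
    where
    open import Relation.Binary.Reasoning.Setoid (mod-setoid m)
    shift : ∀ c w z → (c * w) * z ≡ w * (c * z)
    shift = solve-∀

  ^-*-distrib : ∀ x y n → (x * y) ^ n ≡ x ^ n * y ^ n
  ^-*-distrib x y zero    = refl
  ^-*-distrib x y (suc n) = trans (cong (x * y *_) (^-*-distrib x y n)) (regroup x y (x ^ n) (y ^ n))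
    where
    regroup : ∀ x y u v → x * y * (u * v) ≡ x * u * (y * v)
    regroup = solve-∀

  ^-≡1-* : ∀ {m x K} j → x ^ K ≡ 1ℤ [mod m ] → x ^ (j ℕ.* K) ≡ 1ℤ [mod m ]
  ^-≡1-* {m} {x} {K} j xᴷ≡1 = begin
    x ^ (j ℕ.* K)   ≡⟨ trans (cong (x ^_) (ℕ.*-comm j K)) (sym (ℤ.^-*-assoc x K j)) ⟩
    (x ^ K) ^ j     ≈⟨ ^-cong-mod j xᴷ≡1 ⟩
    1ℤ ^ j          ≡⟨ ℤ.^-zeroˡ j ⟩
    1ℤ              ∎
    where open import Relation.Binary.Reasoning.Setoid (mod-setoid m)

  Periodic : ℤ → (ℕ → ℤ) → ℕ → Set
  Periodic m f k = ∀ n → f (n ℕ.+ k) ≡ f n [mod m ]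

  periodic-* : ∀ {m f k} → Periodic m f k → ∀ j → Periodic m f (j ℕ.* k)
  periodic-* {m} {f} {k} f-per zero    n = mod-reflexive (cong f (ℕ.+-identityʳ n))
  periodic-* {m} {f} {k} f-per (suc j) n = begin
    f (n ℕ.+ (k ℕ.+ j ℕ.* k))   ≡⟨ cong f (ℕ.+-assoc n k (j ℕ.* k)) ⟨
    f (n ℕ.+ k ℕ.+ j ℕ.* k)     ≈⟨ periodic-* f-per j (n ℕ.+ k) ⟩
    f (n ℕ.+ k)                 ≈⟨ f-per n ⟩
    f n                         ∎
    where open import Relation.Binary.Reasoning.Setoid (mod-setoid m)

  periodic-transfer : ∀ {m c u v} K .{{_ : ℕ.NonZero K}} → c ^ K ≡ 1ℤ [mod m ] →
                      (∀ n → c ^ n * u n ≡ c * v n) → Periodic m v K → Periodic m u K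
  periodic-transfer {m} {c} {u} {v} K cᴷ≡1 cⁿu≡cv v-per n = begin
    u (n ℕ.+ K)               ≡⟨ ℤ.*-identityˡ _ ⟨
    1ℤ * u (n ℕ.+ K)          ≈⟨ *-cong-mod (mod-sym cᴷ≡1) mod-refl ⟩
    c ^ K * u (n ℕ.+ K)       ≈⟨ *-cancelˡ-mod K cⁿᴷ≡1 shifted ⟩
    u n                       ∎
    where
    open import Relation.Binary.Reasoning.Setoid (mod-setoid m)
    cⁿᴷ≡1 : (c ^ n) ^ K ≡ 1ℤ [mod m ]
    cⁿᴷ≡1 = subst (λ y → y ≡ 1ℤ [mod m ]) (sym (ℤ.^-*-assoc c n K)) (^-≡1-* n cᴷ≡1)
    shifted : c ^ n * (c ^ K * u (n ℕ.+ K)) ≡ c ^ n * u n [mod m ]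
    shifted = begin
      c ^ n * (c ^ K * u (n ℕ.+ K))   ≡⟨ ℤ.*-assoc (c ^ n) (c ^ K) _ ⟨
      c ^ n * c ^ K * u (n ℕ.+ K)     ≡⟨ cong (_* u (n ℕ.+ K)) (ℤ.^-distribˡ-+-* c n K) ⟨
      c ^ (n ℕ.+ K) * u (n ℕ.+ K)     ≡⟨ cⁿu≡cv (n ℕ.+ K) ⟩
      c * v (n ℕ.+ K)                 ≈⟨ *-congˡ-mod c (v-per n) ⟩
      c * v n                         ≡⟨ cⁿu≡cv n ⟨
      c ^ n * u n                     ∎

  least-period-∣ : ∀ {m f k N} → IsLeastPeriodMod m f k → Periodic (+ m) f N → k ℕ.∣ N
  least-period-∣ {m} {f} {suc k′} {N} (_ , k-period , k-least) N-period with N % suc k′ in N%k≡r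
  ... | zero   = ℕ.m%n≡0⇒n∣m N (suc k′) N%k≡r
  ... | suc r′ = contradiction (k-least (suc r′) (s≤s z≤n) r-period)
                               (ℕ.<⇒≱ (subst (ℕ._< suc k′) N%k≡r (m%n<n N (suc k′))))
    where
    k = suc k′
    N≡r+qk : N ≡ suc r′ ℕ.+ (N / k) ℕ.* k
    N≡r+qk = trans (m≡m%n+[m/n]*n N k) (cong (ℕ._+ (N / k) ℕ.* k) N%k≡r)
    k-periodic : Periodic (+ m) f k
    k-periodic n = mod∣ (∣ᵤ⇒∣ (k-period n))
    r-period : IsPeriodMod m f (suc r′)
    r-period n = ∣⇒∣ᵤ (∣-mod (begin
      f (n ℕ.+ suc r′)                          ≈⟨ periodic-* k-periodic (N / k) (n ℕ.+ suc r′) ⟨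
      f (n ℕ.+ suc r′ ℕ.+ (N / k) ℕ.* k)
        ≡⟨ cong f (trans (ℕ.+-assoc n (suc r′) _) (cong (n ℕ.+_) (sym N≡r+qk))) ⟩
      f (n ℕ.+ N)                               ≈⟨ N-period n ⟩
      f n                                       ∎))
      where open import Relation.Binary.Reasoning.Setoid (mod-setoid (+ m))

module FermatEuler where

  open import Data.Nat as ℕ using (ℕ; zero; suc; _∸_; z≤n; s≤s)
  import Data.Nat.Properties as ℕ
  import Data.Nat.Tactic.RingSolver as ℕS
  open import Data.Nat.Combinatorics using (_C_; nCn≡1; nC1≡n; nCk+nC[k+1]≡[n+1]C[k+1])
  open import Data.Nat.Combinatorics.Specification using (k>n⇒nCk≡0)
  import Data.Nat.Divisibility as ℕ
  open import Data.Nat.Primality using (Prime; euclidsLemma; prime⇒nonZero)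
  open import Data.Integer as ℤ using (ℤ; +_; _+_; _-_; _*_; _^_; 0ℤ; 1ℤ)
  import Data.Integer.Properties as ℤ
  open import Data.Integer.Divisibility.Signed
  open import Data.Integer.Tactic.RingSolver using (solve-∀)
  open import Data.Sum using (_⊎_; inj₁; inj₂)
  open import Relation.Binary.PropositionalEquality
    using (_≡_; refl; sym; trans; cong; cong₂; subst; module ≡-Reasoning)
  open import Relation.Nullary using (¬_; contradiction)
  open Congruence

  euclidsLemma-ℤ : ∀ {p} → Prime p → ∀ x y → + p ∣ x * y → + p ∣ x ⊎ + p ∣ y
  euclidsLemma-ℤ {p} p-prime x y p∣xy
    with euclidsLemma ℤ.∣ x ∣ ℤ.∣ y ∣ p-prime (subst (p ℕ.∣_) (ℤ.abs-* x y) (∣⇒∣ᵤ p∣xy))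
  ... | inj₁ p∣x = inj₁ (∣ᵤ⇒∣ p∣x)
  ... | inj₂ p∣y = inj₂ (∣ᵤ⇒∣ p∣y)

  [k+1]*[n+1]C[k+1]≡[n+1]*nCk : ∀ n k → suc k ℕ.* (suc n C suc k) ≡ suc n ℕ.* (n C k)
  [k+1]*[n+1]C[k+1]≡[n+1]*nCk zero    zero    = refl
  [k+1]*[n+1]C[k+1]≡[n+1]*nCk zero    (suc k) =
    trans (cong (suc (suc k) ℕ.*_) (k>n⇒nCk≡0 {1} {suc (suc k)} (s≤s (s≤s z≤n)))) (ℕ.*-zeroʳ (suc (suc k)))
  [k+1]*[n+1]C[k+1]≡[n+1]*nCk (suc n) zero    =
    trans (ℕ.*-identityˡ _) (trans (nC1≡n (suc (suc n))) (sym (ℕ.*-identityʳ _)))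
  [k+1]*[n+1]C[k+1]≡[n+1]*nCk (suc n) (suc k) = begin
    suc (suc k) ℕ.* (suc (suc n) C suc (suc k))
      ≡⟨ cong (suc (suc k) ℕ.*_) (nCk+nC[k+1]≡[n+1]C[k+1] (suc n) (suc k)) ⟨
    suc (suc k) ℕ.* (c₁ ℕ.+ c₂)
      ≡⟨ split k c₁ c₂ ⟩
    suc k ℕ.* c₁ ℕ.+ c₁ ℕ.+ suc (suc k) ℕ.* c₂
      ≡⟨ cong₂ (λ u v → u ℕ.+ c₁ ℕ.+ v)
           ([k+1]*[n+1]C[k+1]≡[n+1]*nCk n k) ([k+1]*[n+1]C[k+1]≡[n+1]*nCk n (suc k)) ⟩
    suc n ℕ.* (n C k) ℕ.+ c₁ ℕ.+ suc n ℕ.* (n C suc k)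
      ≡⟨ merge n (n C k) (n C suc k) c₁ ⟩
    suc n ℕ.* (n C k ℕ.+ n C suc k) ℕ.+ c₁
      ≡⟨ cong (λ u → suc n ℕ.* u ℕ.+ c₁) (nCk+nC[k+1]≡[n+1]C[k+1] n k) ⟩
    suc n ℕ.* c₁ ℕ.+ c₁
      ≡⟨ ℕ.+-comm (suc n ℕ.* c₁) c₁ ⟩
    suc (suc n) ℕ.* c₁ ∎
    where
    open ≡-Reasoning
    c₁ = suc n C suc k
    c₂ = suc n C suc (suc k)
    split : ∀ k a b → suc (suc k) ℕ.* (a ℕ.+ b) ≡ suc k ℕ.* a ℕ.+ a ℕ.+ suc (suc k) ℕ.* b
    split = ℕS.solve-∀
    merge : ∀ n a b c → suc n ℕ.* a ℕ.+ c ℕ.+ suc n ℕ.* b ≡ suc n ℕ.* (a ℕ.+ b) ℕ.+ c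
    merge = ℕS.solve-∀

  prime∣pCk : ∀ {p k} → Prime p → 0 ℕ.< k → k ℕ.< p → p ℕ.∣ p C k
  prime∣pCk {suc n} {suc j} p-prime _ k<p
    with euclidsLemma (suc j) (suc n C suc j) p-prime
           (ℕ.divides (n C j) (trans ([k+1]*[n+1]C[k+1]≡[n+1]*nCk n j) (ℕ.*-comm (suc n) (n C j))))
  ... | inj₁ p∣k = contradiction (ℕ.∣⇒≤ p∣k) (ℕ.<⇒≱ k<p)
  ... | inj₂ p∣C = p∣C

  binomialSum : ℤ → ℕ → ℕ → ℤ
  binomialSum x n zero    = 0ℤ
  binomialSum x n (suc k) = binomialSum x n k + + (n C k) * x ^ k

  binomialSum-pascal : ∀ x n k →
    binomialSum x (suc n) (suc k) ≡ x * binomialSum x n k + binomialSum x n (suc k)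
  binomialSum-pascal x n zero    = sym (cong (_+ 1ℤ) (ℤ.*-zeroʳ x))
  binomialSum-pascal x n (suc k) = begin
    binomialSum x (suc n) (suc k) + + (suc n C suc k) * x ^ suc k
      ≡⟨ cong₂ (λ s c → s + + c * x ^ suc k)
           (binomialSum-pascal x n k) (sym (nCk+nC[k+1]≡[n+1]C[k+1] n k)) ⟩
    (x * binomialSum x n k + binomialSum x n (suc k)) + + (n C k ℕ.+ n C suc k) * x ^ suc k
      ≡⟨ cong (λ c → (x * binomialSum x n k + binomialSum x n (suc k)) + c * x ^ suc k)
           (ℤ.pos-+ (n C k) (n C suc k)) ⟩
    (x * binomialSum x n k + binomialSum x n (suc k)) + (+ (n C k) + + (n C suc k)) * (x * x ^ k)
      ≡⟨ regroup x (binomialSum x n k) (binomialSum x n (suc k)) (+ (n C k)) (+ (n C suc k)) (x ^ k) ⟩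
    x * (binomialSum x n k + + (n C k) * x ^ k) + (binomialSum x n (suc k) + + (n C suc k) * x ^ suc k) ∎
    where
    open ≡-Reasoning
    regroup : ∀ x s s′ c c′ w → (x * s + s′) + (c + c′) * (x * w) ≡ x * (s + c * w) + (s′ + c′ * (x * w))
    regroup = solve-∀

  binomial-theorem : ∀ x n → (1ℤ + x) ^ n ≡ binomialSum x n (suc n)
  binomial-theorem x zero    = refl
  binomial-theorem x (suc n) = begin
    (1ℤ + x) * (1ℤ + x) ^ n                                      ≡⟨ cong ((1ℤ + x) *_) (binomial-theorem x n) ⟩
    (1ℤ + x) * binomialSum x n (suc n)                            ≡⟨ regroup x (binomialSum x n (suc n)) (x ^ suc n) ⟩
    x * binomialSum x n (suc n) + (binomialSum x n (suc n) + 0ℤ * x ^ suc n)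
      ≡⟨ cong (λ c → x * binomialSum x n (suc n) + (binomialSum x n (suc n) + + c * x ^ suc n))
           (k>n⇒nCk≡0 (ℕ.n<1+n n)) ⟨
    x * binomialSum x n (suc n) + binomialSum x n (suc (suc n))   ≡⟨ binomialSum-pascal x n (suc n) ⟨
    binomialSum x (suc n) (suc (suc n))                           ∎
    where
    open ≡-Reasoning
    regroup : ∀ x s w → (1ℤ + x) * s ≡ x * s + (s + 0ℤ * w)
    regroup = solve-∀

  module _ {p : ℕ} (p-prime : Prime p) where

    private
      P = + p

    binomialSum-≡1 : ∀ x k → 0 ℕ.< k → k ℕ.≤ p → binomialSum x p k ≡ 1ℤ [mod P ]
    binomialSum-≡1 x (suc zero)    _ _   = mod-reflexive refl
    binomialSum-≡1 x (suc (suc k)) _ k≤p = begin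
      binomialSum x p (suc k) + + (p C suc k) * x ^ suc k
        ≈⟨ +-cong-mod (binomialSum-≡1 x (suc k) (s≤s z≤n) (ℕ.<⇒≤ k≤p))
                      (∣⇒≡0-mod (∣m⇒∣m*n (x ^ suc k) P∣pCk)) ⟩
      1ℤ + 0ℤ ≡⟨⟩
      1ℤ ∎
      where
      open import Relation.Binary.Reasoning.Setoid (mod-setoid P)
      P∣pCk : P ∣ + (p C suc k)
      P∣pCk = ∣ᵤ⇒∣ (prime∣pCk p-prime (s≤s z≤n) k≤p)

    private
      instance
        p≢0 : ℕ.NonZero p
        p≢0 = prime⇒nonZero p-prime

      p≡1+[p-1] : p ≡ suc (p ∸ 1)
      p≡1+[p-1] = sym (ℕ.suc-pred p)

    frobenius : ∀ x → (1ℤ + x) ^ p ≡ 1ℤ + x ^ p [mod P ]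
    frobenius x = begin
      (1ℤ + x) ^ p                              ≡⟨ binomial-theorem x p ⟩
      binomialSum x p p + + (p C p) * x ^ p     ≡⟨ cong (λ c → binomialSum x p p + + c * x ^ p) (nCn≡1 p) ⟩
      binomialSum x p p + 1ℤ * x ^ p            ≈⟨ +-cong-mod (binomialSum-≡1 x p (ℕ.>-nonZero⁻¹ p) ℕ.≤-refl)
                                                               (mod-reflexive (ℤ.*-identityˡ (x ^ p))) ⟩
      1ℤ + x ^ p                                ∎
      where open import Relation.Binary.Reasoning.Setoid (mod-setoid P)

    fermat : ∀ a → (+ a) ^ p ≡ + a [mod P ]
    fermat zero    = mod-reflexive (subst (λ n → 0ℤ ^ n ≡ 0ℤ) (sym p≡1+[p-1]) refl)
    fermat (suc a) = mod-trans (frobenius (+ a)) (+-congˡ-mod 1ℤ (fermat a))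

    fermat-∤ : ∀ {a} → ¬ p ℕ.∣ a → (+ a) ^ (p ∸ 1) ≡ 1ℤ [mod P ]
    fermat-∤ {a} p∤a with euclidsLemma-ℤ p-prime (+ a) ((+ a) ^ (p ∸ 1) - 1ℤ) P∣a[aᵖ⁻¹-1]
      where
      P∣a[aᵖ⁻¹-1] : P ∣ + a * ((+ a) ^ (p ∸ 1) - 1ℤ)
      P∣a[aᵖ⁻¹-1] = subst (P ∣_) (factor (+ a) ((+ a) ^ (p ∸ 1)))
                      (∣-mod (subst (λ n → (+ a) ^ n ≡ + a [mod P ]) p≡1+[p-1] (fermat a)))
        where
        factor : ∀ a w → a * w - a ≡ a * (w - 1ℤ)
        factor = solve-∀
    ... | inj₁ P∣a          = contradiction (∣⇒∣ᵤ P∣a) p∤a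
    ... | inj₂ P∣aᵖ⁻¹-1     = mod∣ P∣aᵖ⁻¹-1

  ^-≡-1+n[x-1] : ∀ {m x} → x ≡ 1ℤ [mod m ] → ∀ n → x ^ n ≡ 1ℤ + + n * (x - 1ℤ) [mod m * m ]
  ^-≡-1+n[x-1] {m} {x} x≡1 zero    = mod-refl
  ^-≡-1+n[x-1] {m} {x} x≡1 (suc n) = begin
    x * x ^ n                                              ≈⟨ *-congˡ-mod x (^-≡-1+n[x-1] x≡1 n) ⟩
    x * (1ℤ + + n * (x - 1ℤ))                              ≡⟨ expand x (+ n) ⟩
    (1ℤ + (1ℤ + + n) * (x - 1ℤ)) + + n * ((x - 1ℤ) * (x - 1ℤ))
      ≈⟨ +-congˡ-mod (1ℤ + (1ℤ + + n) * (x - 1ℤ)) (∣⇒≡0-mod (∣n⇒∣m*n (+ n) m²∣[x-1]²)) ⟩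
    (1ℤ + (1ℤ + + n) * (x - 1ℤ)) + 0ℤ                      ≡⟨ ℤ.+-identityʳ _ ⟩
    1ℤ + + suc n * (x - 1ℤ)                                 ∎
    where
    open import Relation.Binary.Reasoning.Setoid (mod-setoid (m * m))
    m²∣[x-1]² : m * m ∣ (x - 1ℤ) * (x - 1ℤ)
    m²∣[x-1]² = *-∣-* (∣-mod x≡1) (∣-mod x≡1)
    expand : ∀ x n → x * (1ℤ + n * (x - 1ℤ)) ≡ (1ℤ + (1ℤ + n) * (x - 1ℤ)) + n * ((x - 1ℤ) * (x - 1ℤ))
    expand = solve-∀

  ^-lift : ∀ {x} q → x ≡ 1ℤ [mod + q ] → x ^ q ≡ 1ℤ [mod + q * + q ]
  ^-lift {x} q x≡1 = mod-trans (^-≡-1+n[x-1] x≡1 q)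
    (mod-trans (+-congˡ-mod 1ℤ (∣⇒≡0-mod (*-∣-* (∣-refl {+ q}) (∣-mod x≡1))))
               (mod-reflexive (ℤ.+-identityʳ 1ℤ)))

  euler-p² : ∀ {p a} → Prime p → ¬ p ℕ.∣ a → (+ a) ^ (p ℕ.* (p ∸ 1)) ≡ 1ℤ [mod + p * + p ]
  euler-p² {p} {a} p-prime p∤a = subst (λ y → y ≡ 1ℤ [mod + p * + p ])
    (trans (ℤ.^-*-assoc (+ a) (p ∸ 1) p) (cong ((+ a) ^_) (ℕ.*-comm (p ∸ 1) p)))
    (^-lift p (fermat-∤ p-prime p∤a))

module LucasSequences where

  open import Data.Nat as ℕ using (ℕ; zero; suc; _∸_)
  import Data.Nat.Properties as ℕ
  import Data.Nat.Divisibility as ℕ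
  open import Data.Nat.Primality using (Prime; prime⇒nonZero; prime⇒nonTrivial)
  open import Data.Integer as ℤ using (ℤ; +_; _+_; _-_; _*_; _^_; 0ℤ; 1ℤ)
  import Data.Integer.Properties as ℤ
  open import Data.Integer.Divisibility.Signed
  open import Data.Integer.Tactic.RingSolver using (solve-∀)
  open import Data.Product using (_×_; _,_; proj₁)
  open import Data.Sum using (inj₁; inj₂)
  open import Relation.Binary.PropositionalEquality using (_≡_; refl; sym; trans; cong; cong₂; subst)
  open import Relation.Nullary using (¬_; contradiction)
  open import Defs using (𝓕; 𝓛)
  open Congruence
  open FermatEuler

  record Recurrence (a b : ℤ) (u : ℕ → ℤ) : Set where
    constructor recurrence
    field step : ∀ n → u (suc (suc n)) ≡ a * u (suc n) + b * u n

  recurrence-unique : ∀ {a b u v} → Recurrence a b u → Recurrence a b v →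
                      u 0 ≡ v 0 → u 1 ≡ v 1 → ∀ n → u n ≡ v n
  recurrence-unique {a} {b} {u} {v} (recurrence rec-u) (recurrence rec-v) u₀≡v₀ u₁≡v₁ n = proj₁ (agree n)
    where
    agree : ∀ n → u n ≡ v n × u (suc n) ≡ v (suc n)
    agree zero    = u₀≡v₀ , u₁≡v₁
    agree (suc n) with agree n
    ... | uₙ≡vₙ , uₙ₊₁≡vₙ₊₁ =
      uₙ₊₁≡vₙ₊₁ ,
      trans (rec-u n) (trans (cong₂ (λ x y → a * x + b * y) uₙ₊₁≡vₙ₊₁ uₙ≡vₙ) (sym (rec-v n)))

  recurrence-scale : ∀ {a b u} c → Recurrence a b u → Recurrence a b (λ n → c * u n)
  recurrence-scale {a} {b} {u} c (recurrence rec) =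
    recurrence λ n → trans (cong (c *_) (rec n)) (regroup c a b (u (suc n)) (u n))
    where
    regroup : ∀ c a b x y → c * (a * x + b * y) ≡ a * (c * x) + b * (c * y)
    regroup = solve-∀

  recurrence-2ⁿ : ∀ {a u} → Recurrence a 1ℤ u → Recurrence (+ 2 * a) (+ 4) (λ n → (+ 2) ^ n * u n)
  recurrence-2ⁿ {a} {u} (recurrence rec) = recurrence λ n →
    trans (cong ((+ 2) ^ suc (suc n) *_) (rec n)) (regroup a ((+ 2) ^ n) (u (suc n)) (u n))
    where
    regroup : ∀ a w x y → (+ 2 * (+ 2 * w)) * (a * x + 1ℤ * y) ≡ (+ 2 * a) * (+ 2 * w * x) + + 4 * (w * y)
    regroup = solve-∀

  module Lucas (t : ℤ) where

    D : ℤ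
    D = t * t + + 4

    -- (t + √D)ⁿ = A n + B n √D
    mutual
      A : ℕ → ℤ
      A zero    = 1ℤ
      A (suc n) = t * A n + D * B n

      B : ℕ → ℤ
      B zero    = 0ℤ
      B (suc n) = A n + t * B n

    mutual
      A-+ : ∀ m n → A (m ℕ.+ n) ≡ A m * A n + D * B m * B n
      A-+ zero    n = base D (A n) (B n)
        where
        base : ∀ d a b → a ≡ 1ℤ * a + d * 0ℤ * b
        base = solve-∀
      A-+ (suc m) n = trans (cong₂ (λ x y → t * x + D * y) (A-+ m n) (B-+ m n))
                            (regroup t D (A m) (B m) (A n) (B n))
        where
        regroup : ∀ t d a b a′ b′ →
          t * (a * a′ + d * b * b′) + d * (a * b′ + b * a′) ≡ (t * a + d * b) * a′ + d * (a + t * b) * b′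
        regroup = solve-∀

      B-+ : ∀ m n → B (m ℕ.+ n) ≡ A m * B n + B m * A n
      B-+ zero    n = base (A n) (B n)
        where
        base : ∀ a b → b ≡ 1ℤ * b + 0ℤ * a
        base = solve-∀
      B-+ (suc m) n = trans (cong₂ (λ x y → x + t * y) (A-+ m n) (B-+ m n))
                            (regroup t D (A m) (B m) (A n) (B n))
        where
        regroup : ∀ t d a b a′ b′ →
          (a * a′ + d * b * b′) + t * (a * b′ + b * a′) ≡ (t * a + d * b) * b′ + (a + t * b) * a′
        regroup = solve-∀

    A-recurrence : Recurrence (+ 2 * t) (+ 4) A
    A-recurrence = recurrence λ n → regroup t (A n) (B n)
      where
      regroup : ∀ t a b → t * (t * a + (t * t + + 4) * b) + (t * t + + 4) * (a + t * b)
                          ≡ + 2 * t * (t * a + (t * t + + 4) * b) + + 4 * a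
      regroup = solve-∀

    B-recurrence : Recurrence (+ 2 * t) (+ 4) B
    B-recurrence = recurrence λ n → regroup t (A n) (B n)
      where
      regroup : ∀ t a b → (t * a + (t * t + + 4) * b) + t * (a + t * b) ≡ + 2 * t * (a + t * b) + + 4 * b
      regroup = solve-∀

    2ⁿ𝓛≡2A : ∀ n → (+ 2) ^ n * 𝓛 t n ≡ + 2 * A n
    2ⁿ𝓛≡2A = recurrence-unique (recurrence-2ⁿ 𝓛-rec) (recurrence-scale (+ 2) A-recurrence)
                               refl (base t D)
      where
      𝓛-rec : Recurrence t 1ℤ (𝓛 t)
      𝓛-rec = recurrence λ n → cong (λ y → t * 𝓛 t (suc n) + y) (sym (ℤ.*-identityˡ (𝓛 t n)))
      base : ∀ t d → + 2 * 1ℤ * t ≡ + 2 * (t * 1ℤ + d * 0ℤ)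
      base = solve-∀

    2ⁿ𝓕≡2B : ∀ n → (+ 2) ^ n * 𝓕 t n ≡ + 2 * B n
    2ⁿ𝓕≡2B = recurrence-unique (recurrence-2ⁿ 𝓕-rec) (recurrence-scale (+ 2) B-recurrence)
                               refl (base t)
      where
      𝓕-rec : Recurrence t 1ℤ (𝓕 t)
      𝓕-rec = recurrence λ n → cong (λ y → t * 𝓕 t (suc n) + y) (sym (ℤ.*-identityˡ (𝓕 t n)))
      base : ∀ t → + 2 * 1ℤ * 1ℤ ≡ + 2 * (1ℤ + t * 0ℤ)
      base = solve-∀

    module _ {q : ℤ} (q∣D : q ∣ D) where

      A≡tⁿ : ∀ n → A n ≡ t ^ n [mod q ]
      A≡tⁿ zero    = mod-refl
      A≡tⁿ (suc n) = begin
        t * A n + D * B n     ≈⟨ +-cong-mod (*-congˡ-mod t (A≡tⁿ n)) (∣⇒≡0-mod (∣m⇒∣m*n (B n) q∣D)) ⟩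
        t * t ^ n + 0ℤ        ≡⟨ ℤ.+-identityʳ (t ^ suc n) ⟩
        t ^ suc n             ∎
        where open import Relation.Binary.Reasoning.Setoid (mod-setoid q)

      tB≡ntⁿ : ∀ n → t * B n ≡ + n * t ^ n [mod q ]
      tB≡ntⁿ zero    = mod-reflexive (ℤ.*-zeroʳ t)
      tB≡ntⁿ (suc n) = begin
        t * (A n + t * B n)           ≡⟨ ℤ.*-distribˡ-+ t (A n) (t * B n) ⟩
        t * A n + t * (t * B n)       ≈⟨ +-cong-mod (*-congˡ-mod t (A≡tⁿ n)) (*-congˡ-mod t (tB≡ntⁿ n)) ⟩
        t * t ^ n + t * (+ n * t ^ n) ≡⟨ regroup t (+ n) (t ^ n) ⟩
        + suc n * t ^ suc n           ∎
        where
        open import Relation.Binary.Reasoning.Setoid (mod-setoid q)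
        regroup : ∀ t n w → t * w + t * (n * w) ≡ (1ℤ + n) * (t * w)
        regroup = solve-∀

      -- Aₙ ≡ tⁿ + (n choose 2) tⁿ⁻² D (mod q²), multiplied by 2t² to stay in ℤ
      2t²A≡2t²tⁿ+Dn[n-1]tⁿ : ∀ n → (+ 2 * t * t) * A n
                                    ≡ (+ 2 * t * t) * t ^ n + D * (+ n * (+ n - 1ℤ)) * t ^ n [mod q * q ]
      2t²A≡2t²tⁿ+Dn[n-1]tⁿ zero    = mod-reflexive (base t D)
        where
        base : ∀ t d → (+ 2 * t * t) * 1ℤ ≡ (+ 2 * t * t) * 1ℤ + d * (0ℤ * (0ℤ - 1ℤ)) * 1ℤ
        base = solve-∀
      2t²A≡2t²tⁿ+Dn[n-1]tⁿ (suc n) = begin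
        (+ 2 * t * t) * (t * A n + D * B n)
          ≡⟨ regroup₁ t D (A n) (B n) ⟩
        t * ((+ 2 * t * t) * A n) + (+ 2 * t * D) * (t * B n)
          ≈⟨ +-cong-mod (*-congˡ-mod t (2t²A≡2t²tⁿ+Dn[n-1]tⁿ n))
                        (*-cong-mod-∣ (∣n⇒∣m*n (+ 2 * t) q∣D) (tB≡ntⁿ n)) ⟩
        t * ((+ 2 * t * t) * t ^ n + D * (+ n * (+ n - 1ℤ)) * t ^ n) + (+ 2 * t * D) * (+ n * t ^ n)
          ≡⟨ regroup₂ t D (+ n) (t ^ n) ⟩
        (+ 2 * t * t) * t ^ suc n + D * (+ suc n * (+ suc n - 1ℤ)) * t ^ suc n ∎
        where
        open import Relation.Binary.Reasoning.Setoid (mod-setoid (q * q))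
        regroup₁ : ∀ t d a b → (+ 2 * t * t) * (t * a + d * b) ≡ t * ((+ 2 * t * t) * a) + (+ 2 * t * d) * (t * b)
        regroup₁ = solve-∀
        regroup₂ : ∀ t d n w →
          t * ((+ 2 * t * t) * w + d * (n * (n - 1ℤ)) * w) + (+ 2 * t * d) * (n * w)
            ≡ (+ 2 * t * t) * (t * w) + d * ((1ℤ + n) * ((1ℤ + n) - 1ℤ)) * (t * w)
        regroup₂ = solve-∀

    module _ {m : ℤ} {K : ℕ} (Aᴷ≡1 : A K ≡ 1ℤ [mod m ]) where

      A-periodic : m ∣ D * B K → Periodic m A K
      A-periodic m∣DBᴷ n = begin
        A (n ℕ.+ K)                   ≡⟨ A-+ n K ⟩
        A n * A K + D * B n * B K     ≈⟨ +-cong-mod (*-congˡ-mod (A n) Aᴷ≡1) (∣⇒≡0-mod m∣DBₙBᴷ) ⟩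
        A n * 1ℤ + 0ℤ                 ≡⟨ trans (ℤ.+-identityʳ _) (ℤ.*-identityʳ (A n)) ⟩
        A n                           ∎
        where
        open import Relation.Binary.Reasoning.Setoid (mod-setoid m)
        m∣DBₙBᴷ : m ∣ D * B n * B K
        m∣DBₙBᴷ = subst (m ∣_) (regroup D (B n) (B K)) (∣n⇒∣m*n (B n) m∣DBᴷ)
          where
          regroup : ∀ d b b′ → b * (d * b′) ≡ d * b * b′
          regroup = solve-∀

      B-periodic : m ∣ B K → Periodic m B K
      B-periodic m∣Bᴷ n = begin
        B (n ℕ.+ K)                   ≡⟨ B-+ n K ⟩
        A n * B K + B n * A K
          ≈⟨ +-cong-mod (∣⇒≡0-mod (∣n⇒∣m*n (A n) m∣Bᴷ)) (*-congˡ-mod (B n) Aᴷ≡1) ⟩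
        0ℤ + B n * 1ℤ                 ≡⟨ trans (ℤ.+-identityˡ _) (ℤ.*-identityʳ (B n)) ⟩
        B n                           ∎
        where
        open import Relation.Binary.Reasoning.Setoid (mod-setoid m)

      B-multiple : m ∣ D * B K → ∀ j → B (j ℕ.* K) ≡ + j * B K [mod m ]
      B-multiple m∣DBᴷ zero    = mod-reflexive (sym (ℤ.*-zeroˡ (B K)))
      B-multiple m∣DBᴷ (suc j) = begin
        B (K ℕ.+ j ℕ.* K)                 ≡⟨ B-+ K (j ℕ.* K) ⟩
        A K * B (j ℕ.* K) + B K * A (j ℕ.* K)
          ≈⟨ +-cong-mod (*-cong-mod Aᴷ≡1 (B-multiple m∣DBᴷ j)) (*-congˡ-mod (B K) Aⱼₖ≡1) ⟩
        1ℤ * (+ j * B K) + B K * 1ℤ       ≡⟨ regroup (+ j) (B K) ⟩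
        + suc j * B K                     ∎
        where
        open import Relation.Binary.Reasoning.Setoid (mod-setoid m)
        Aⱼₖ≡1 : A (j ℕ.* K) ≡ 1ℤ [mod m ]
        Aⱼₖ≡1 = periodic-* (A-periodic m∣DBᴷ) j 0
        regroup : ∀ j b → 1ℤ * (j * b) + b * 1ℤ ≡ (1ℤ + j) * b
        regroup = solve-∀

  module OddPrimeDivisor {p : ℕ} (p-prime : Prime p) (p∤2 : ¬ p ℕ.∣ 2) (t : ℕ)
                         (p∣D : + p ∣ Lucas.D (+ t)) where

    open Lucas (+ t)

    private
      P = + p
      K = p ℕ.* (p ∸ 1)

      instance
        p≢0 : ℕ.NonZero p
        p≢0 = prime⇒nonZero p-prime
        p-1≢0 : ℕ.NonZero (p ∸ 1)
        p-1≢0 = ℕ.>-nonZero (ℕ.m<n⇒0<n∸m (ℕ.nonTrivial⇒n>1 p {{prime⇒nonTrivial p-prime}}))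
        K≢0 : ℕ.NonZero K
        K≢0 = ℕ.m*n≢0 p (p ∸ 1)
        pK≢0 : ℕ.NonZero (p ℕ.* K)
        pK≢0 = ℕ.m*n≢0 p K

    p∤t : ¬ p ℕ.∣ t
    p∤t p∣t with euclidsLemma-ℤ p-prime (+ 2) (+ 2) (subst (P ∣_) (D-t² (+ t)) P∣D-t²)
      where
      P∣D-t² : P ∣ D - + t * + t
      P∣D-t² = ∣m∣n⇒∣m-n p∣D (∣m⇒∣m*n (+ t) (∣ᵤ⇒∣ {P} {+ t} p∣t))
      D-t² : ∀ t → (t * t + + 4) - t * t ≡ + 2 * + 2
      D-t² = solve-∀
    ... | inj₁ P∣2 = p∤2 (∣⇒∣ᵤ P∣2)
    ... | inj₂ P∣2 = p∤2 (∣⇒∣ᵤ P∣2)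

    P∣K : P ∣ + K
    P∣K = subst (P ∣_) (sym (ℤ.pos-* p (p ∸ 1))) (∣m⇒∣m*n (+ (p ∸ 1)) ∣-refl)

    tᴷ≡1 : (+ t) ^ K ≡ 1ℤ [mod P * P ]
    tᴷ≡1 = euler-p² p-prime p∤t

    2ᴷ≡1 : (+ 2) ^ K ≡ 1ℤ [mod P * P ]
    2ᴷ≡1 = euler-p² p-prime p∤2

    P∣Bᴷ : P ∣ B K
    P∣Bᴷ with euclidsLemma-ℤ p-prime (+ t) (B K) (≡0-mod⇒∣ tBᴷ≡0)
      where
      tBᴷ≡0 : + t * B K ≡ 0ℤ [mod P ]
      tBᴷ≡0 = mod-trans (tB≡ntⁿ p∣D K) (∣⇒≡0-mod (∣m⇒∣m*n ((+ t) ^ K) P∣K))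
    ... | inj₁ P∣t  = contradiction (∣⇒∣ᵤ P∣t) p∤t
    ... | inj₂ P∣Bᴷ = P∣Bᴷ

    P²∣DBᴷ : P * P ∣ D * B K
    P²∣DBᴷ = *-∣-* p∣D P∣Bᴷ

    Aᴷ≡1 : A K ≡ 1ℤ [mod P * P ]
    Aᴷ≡1 = *-cancelˡ-mod K cᴷ≡1 (begin
      c * A K                                          ≈⟨ 2t²A≡2t²tⁿ+Dn[n-1]tⁿ p∣D K ⟩
      c * (+ t) ^ K + D * (+ K * (+ K - 1ℤ)) * (+ t) ^ K
        ≈⟨ +-cong-mod (*-congˡ-mod c tᴷ≡1) (∣⇒≡0-mod (∣m⇒∣m*n ((+ t) ^ K) P²∣DK[K-1])) ⟩
      c * 1ℤ + 0ℤ                                      ≡⟨ ℤ.+-identityʳ (c * 1ℤ) ⟩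
      c * 1ℤ                                           ∎)
      where
      open import Relation.Binary.Reasoning.Setoid (mod-setoid (P * P))
      c = + 2 * + t * + t
      P²∣DK[K-1] : P * P ∣ D * (+ K * (+ K - 1ℤ))
      P²∣DK[K-1] = *-∣-* p∣D (∣m⇒∣m*n (+ K - 1ℤ) P∣K)
      cᴷ≡1 : c ^ K ≡ 1ℤ [mod P * P ]
      cᴷ≡1 = begin
        c ^ K                               ≡⟨ ^-*-distrib (+ 2 * + t) (+ t) K ⟩
        (+ 2 * + t) ^ K * (+ t) ^ K         ≡⟨ cong (_* (+ t) ^ K) (^-*-distrib (+ 2) (+ t) K) ⟩
        (+ 2) ^ K * (+ t) ^ K * (+ t) ^ K   ≈⟨ *-cong-mod (*-cong-mod 2ᴷ≡1 tᴷ≡1) tᴷ≡1 ⟩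
        1ℤ                                  ∎

    𝓛-periodic : Periodic (P * P) (𝓛 (+ t)) K
    𝓛-periodic = periodic-transfer K 2ᴷ≡1 2ⁿ𝓛≡2A (A-periodic Aᴷ≡1 P²∣DBᴷ)

    𝓕-periodic : Periodic (P * P) (𝓕 (+ t)) (p ℕ.* K)
    𝓕-periodic = periodic-transfer (p ℕ.* K) (^-≡1-* p 2ᴷ≡1) 2ⁿ𝓕≡2B (B-periodic Aᵖᴷ≡1 P²∣Bᵖᴷ)
      where
      Aᵖᴷ≡1 : A (p ℕ.* K) ≡ 1ℤ [mod P * P ]
      Aᵖᴷ≡1 = periodic-* (A-periodic Aᴷ≡1 P²∣DBᴷ) p 0
      P²∣Bᵖᴷ : P * P ∣ B (p ℕ.* K)
      P²∣Bᵖᴷ = ≡0-mod⇒∣ (mod-trans (B-multiple Aᴷ≡1 P²∣DBᴷ p)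
                                   (∣⇒≡0-mod (*-∣-* (∣-refl {P}) P∣Bᴷ)))

module Descent where

  open import Data.Nat as ℕ using (ℕ; zero; suc; _+_; _*_; _≤_; _<_; z≤n; s≤s; _%_)
  import Data.Nat.Properties as ℕ
  open import Data.Nat.Divisibility as ℕ using (_∣_; divides)
  open import Data.Nat.DivMod using ([m+kn]%n≡m%n; m<n⇒m%n≡m; m≡m%n+[m/n]*n)
  open import Data.Nat.GCD using (gcd; gcd[m,n]∣m; gcd[m,n]∣n; gcd-greatest; gcd[m,n]≡0⇒m≡0; gcd[m,n]≤n)
  open import Data.Nat.Coprimality as Coprime using (Coprime; coprime-divisor)
  open import Data.Nat.Primality using (Prime; euclidsLemma; prime⇒nonZero; ¬prime[1])
  import Data.Nat.Tactic.RingSolver as ℕS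
  open import Data.Product using (_×_; _,_; ∃-syntax)
  open import Data.Sum using (_⊎_; inj₁; inj₂)
  open import Relation.Binary.PropositionalEquality
    using (_≡_; _≢_; refl; sym; trans; cong; cong₂; subst; subst₂; module ≡-Reasoning)
  open import Relation.Nullary using (¬_; contradiction)

  coprime-square : ∀ {u v w} → Coprime u v → u * v ≡ w * w → u ≡ gcd u w * gcd u w
  coprime-square {u} {v} {w} u⊥v uv≡w² with gcd u w in g≡gcd
  ... | zero    = gcd[m,n]≡0⇒m≡0 g≡gcd
  ... | g@(suc _) = trans u≡u′g (cong (_* g) (ℕ.∣-antisym u′∣g g∣u′))
    where
    g∣u : g ∣ u
    g∣u = subst (_∣ u) g≡gcd (gcd[m,n]∣m u w)
    g∣w : g ∣ w
    g∣w = subst (_∣ w) g≡gcd (gcd[m,n]∣n u w)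
    u′ = ℕ.quotient g∣u
    w′ = ℕ.quotient g∣w
    u≡u′g : u ≡ u′ * g
    u≡u′g = ℕ._∣_.equality g∣u
    w≡w′g : w ≡ w′ * g
    w≡w′g = ℕ._∣_.equality g∣w
    u′v≡w′²g : u′ * v ≡ w′ * w′ * g
    u′v≡w′²g = ℕ.*-cancelʳ-≡ (u′ * v) (w′ * w′ * g) g (begin
      u′ * v * g          ≡⟨ swap u′ v g ⟩
      u′ * g * v          ≡⟨ cong (_* v) u≡u′g ⟨
      u * v               ≡⟨ uv≡w² ⟩
      w * w               ≡⟨ cong₂ _*_ w≡w′g w≡w′g ⟩
      w′ * g * (w′ * g)   ≡⟨ regroup w′ g ⟩
      w′ * w′ * g * g     ∎)
      where
      open ≡-Reasoning
      swap : ∀ a b c → a * b * c ≡ a * c * b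
      swap = ℕS.solve-∀
      regroup : ∀ a c → a * c * (a * c) ≡ a * a * c * c
      regroup = ℕS.solve-∀
    g∣u′ : g ∣ u′
    g∣u′ = coprime-divisor (λ (d∣g , d∣v) → u⊥v (ℕ.∣-trans d∣g g∣u , d∣v))
                           (divides (w′ * w′) (trans (ℕ.*-comm v u′) u′v≡w′²g))
    u′⊥w′ : Coprime u′ w′
    u′⊥w′ {d} (d∣u′ , d∣w′) = ℕ.∣1⇒≡1 (ℕ.*-cancelʳ-∣ g dg∣1g)
      where
      dg∣1g : d * g ∣ 1 * g
      dg∣1g = subst (d * g ∣_) (trans g≡gcd (sym (ℕ.*-identityˡ g)))
                (gcd-greatest (subst (d * g ∣_) (sym u≡u′g) (ℕ.*-monoˡ-∣ g d∣u′))
                              (subst (d * g ∣_) (sym w≡w′g) (ℕ.*-monoˡ-∣ g d∣w′)))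
    u′∣g : u′ ∣ g
    u′∣g = coprime-divisor u′⊥w′ (coprime-divisor u′⊥w′
             (divides v (trans (sym (ℕ.*-assoc w′ w′ g)) (trans (sym u′v≡w′²g) (ℕ.*-comm u′ v)))))

  data SquareSplit (p u v x y : ℕ) : Set where
    first-square  : u ≡ x * x → v ≡ p * (y * y) → SquareSplit p u v x y
    second-square : u ≡ p * (y * y) → v ≡ x * x → SquareSplit p u v x y

  SquareSplit-swap : ∀ {p u v x y} → SquareSplit p u v x y → SquareSplit p v u x y
  SquareSplit-swap (first-square u≡x² v≡py²)  = second-square v≡py² u≡x²
  SquareSplit-swap (second-square u≡py² v≡x²) = first-square v≡x² u≡py²

  module _ {p : ℕ} (p-prime : Prime p) where

    private
      instance
        p≢0 : ℕ.NonZero p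
        p≢0 = prime⇒nonZero p-prime

    coprime-split-∣ˡ : ∀ {u v w} → Coprime u v → p ∣ u → u * v ≡ p * (w * w) → 0 < w →
                       ∃[ x ] ∃[ y ] y ≤ w × SquareSplit p u v x y
    coprime-split-∣ˡ {u} {v} {w@(suc _)} u⊥v (divides u′ u≡u′p) uv≡pw² _ =
      gcd v w , gcd u′ w , gcd[m,n]≤n u′ w ,
      second-square (trans u≡u′p (trans (cong (_* p) (coprime-square u′⊥v u′v≡w²)) (ℕ.*-comm _ p)))
                    (coprime-square (Coprime.sym u′⊥v) (trans (ℕ.*-comm v u′) u′v≡w²))
      where
      u′v≡w² : u′ * v ≡ w * w
      u′v≡w² = ℕ.*-cancelˡ-≡ (u′ * v) (w * w) p
                 (trans (regroup p u′ v) (trans (cong (_* v) (sym u≡u′p)) uv≡pw²))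
        where
        regroup : ∀ p a b → p * (a * b) ≡ a * p * b
        regroup = ℕS.solve-∀
      u′⊥v : Coprime u′ v
      u′⊥v (d∣u′ , d∣v) = u⊥v (ℕ.∣-trans d∣u′ (divides p (trans u≡u′p (ℕ.*-comm u′ p))) , d∣v)

    coprime-split : ∀ {u v w} → Coprime u v → u * v ≡ p * (w * w) → 0 < w →
                    ∃[ x ] ∃[ y ] y ≤ w × SquareSplit p u v x y
    coprime-split {u} {v} {w} u⊥v uv≡pw² 0<w
      with euclidsLemma u v p-prime (divides (w * w) (trans uv≡pw² (ℕ.*-comm p (w * w))))
    ... | inj₁ p∣u = coprime-split-∣ˡ u⊥v p∣u uv≡pw² 0<w
    ... | inj₂ p∣v with coprime-split-∣ˡ (Coprime.sym u⊥v) p∣v (trans (ℕ.*-comm v u) uv≡pw²) 0<w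
    ...   | x , y , y≤w , split = x , y , y≤w , SquareSplit-swap split

  even⊎odd : ∀ n → (∃[ j ] n ≡ j * 2) ⊎ (∃[ j ] n ≡ 1 + j * 2)
  even⊎odd zero    = inj₁ (0 , refl)
  even⊎odd (suc n) with even⊎odd n
  ... | inj₁ (j , refl) = inj₂ (j , refl)
  ... | inj₂ (j , refl) = inj₁ (suc j , refl)

  even≢odd : ∀ i j → i * 2 ≢ 1 + j * 2
  even≢odd zero    j       ()
  even≢odd (suc i) zero    ()
  even≢odd (suc i) (suc j) eq = even≢odd i j (ℕ.suc-injective (ℕ.suc-injective eq))

  residue-unique : ∀ {e e′} a b → e < 4 → e′ < 4 → e + a * 4 ≡ e′ + b * 4 → e ≡ e′
  residue-unique {e} {e′} a b e<4 e′<4 eq = begin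
    e                 ≡⟨ m<n⇒m%n≡m e<4 ⟨
    e % 4             ≡⟨ [m+kn]%n≡m%n e a 4 ⟨
    (e + a * 4) % 4   ≡⟨ cong (_% 4) eq ⟩
    (e′ + b * 4) % 4  ≡⟨ [m+kn]%n≡m%n e′ b 4 ⟩
    e′ % 4            ≡⟨ m<n⇒m%n≡m e′<4 ⟩
    e′                ∎
    where open ≡-Reasoning

  ∣4⇒≡1⊎2∣ : ∀ {d} → d ∣ 4 → d ≡ 1 ⊎ 2 ∣ d
  ∣4⇒≡1⊎2∣ {0}  d∣4 = contradiction (ℕ.0∣⇒≡0 d∣4) λ ()
  ∣4⇒≡1⊎2∣ {1}  _   = inj₁ refl
  ∣4⇒≡1⊎2∣ {2}  _   = inj₂ ℕ.∣-refl
  ∣4⇒≡1⊎2∣ {3}  (divides 0 ())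
  ∣4⇒≡1⊎2∣ {3}  (divides 1 ())
  ∣4⇒≡1⊎2∣ {3}  (divides (suc (suc _)) ())
  ∣4⇒≡1⊎2∣ {4}  _   = inj₂ (divides 2 refl)
  ∣4⇒≡1⊎2∣ {suc (suc (suc (suc (suc d))))} d∣4 =
    contradiction (ℕ.∣⇒≤ d∣4) λ { (s≤s (s≤s (s≤s (s≤s ())))) }

  odd⊥odd+4 : ∀ j → Coprime (1 + j * 2) (1 + j * 2 + 4)
  odd⊥odd+4 j {d} (d∣s , d∣s+4) with ∣4⇒≡1⊎2∣ (ℕ.∣m+n∣m⇒∣n d∣s+4 d∣s)
  ... | inj₁ d≡1 = d≡1
  ... | inj₂ 2∣d with ℕ.∣-trans 2∣d d∣s
  ...   | divides q s≡q*2 = contradiction (sym s≡q*2) (even≢odd q j)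

  consecutive-coprime : ∀ i → Coprime i (i + 1)
  consecutive-coprime i (d∣i , d∣i+1) = ℕ.∣1⇒≡1 (ℕ.∣m+n∣m⇒∣n d∣i+1 d∣i)

  SquareSplit-*4 : ∀ {p u v x y} → SquareSplit p u v x y → SquareSplit p (u * 4) (v * 4) (x * 2) (y * 2)
  SquareSplit-*4 {p} {u} {v} {x} {y} (first-square u≡x² v≡py²) =
    first-square (trans (cong (_* 4) u≡x²) (scale-square x)) (trans (cong (_* 4) v≡py²) (scale-p*square p y))
    where
    scale-square : ∀ x → x * x * 4 ≡ x * 2 * (x * 2)
    scale-square = ℕS.solve-∀
    scale-p*square : ∀ p y → p * (y * y) * 4 ≡ p * (y * 2 * (y * 2))
    scale-p*square = ℕS.solve-∀
  SquareSplit-*4 {p} {u} {v} {x} {y} (second-square u≡py² v≡x²) =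
    SquareSplit-swap (SquareSplit-*4 {p} {v} {u} {x} {y} (first-square v≡x² u≡py²))

  module _ {p : ℕ} (p-prime : Prime p) (p≡1[4] : p % 4 ≡ 1) where

    private
      r = p ℕ./ 4
      p≡1+r*4 : p ≡ 1 + r * 4
      p≡1+r*4 = trans (m≡m%n+[m/n]*n p 4) (cong (_+ r * 4) p≡1[4])

    p*even²≡0[4] : ∀ d → ∃[ a ] p * (d * 2 * (d * 2)) ≡ 0 + a * 4
    p*even²≡0[4] d = (1 + r * 4) * (d * d) , trans (cong (λ p → p * (d * 2 * (d * 2))) p≡1+r*4) (expand r d)
      where
      expand : ∀ r d → (1 + r * 4) * (d * 2 * (d * 2)) ≡ 0 + (1 + r * 4) * (d * d) * 4
      expand = ℕS.solve-∀

    p*odd²≡1[4] : ∀ d → ∃[ a ] p * ((1 + d * 2) * (1 + d * 2)) ≡ 1 + a * 4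
    p*odd²≡1[4] d = d + d * d + r * (1 + d * 4 + d * d * 4) ,
                    trans (cong (λ p → p * ((1 + d * 2) * (1 + d * 2))) p≡1+r*4) (expand r d)
      where
      expand : ∀ r d → (1 + r * 4) * ((1 + d * 2) * (1 + d * 2)) ≡ 1 + (d + d * d + r * (1 + d * 4 + d * d * 4)) * 4
      expand = ℕS.solve-∀

    p*square-even : ∀ {c x} → p * (c * c) ≡ x * 2 → ∃[ d ] c ≡ d * 2
    p*square-even {c} {x} pc²≡2x with even⊎odd c
    ... | inj₁ c-even = c-even
    ... | inj₂ (d , refl) with p*odd²≡1[4] d
    ...   | a , pc²≡1+4a = contradiction (trans (sym pc²≡2x) (trans pc²≡1+4a (regroup a))) (even≢odd x (a * 2))
      where
      regroup : ∀ a → 1 + a * 4 ≡ 1 + a * 2 * 2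
      regroup = ℕS.solve-∀

    private
      odd*[odd+2]≡3[4] : ∀ i → (1 + i * 2) * (1 + i * 2 + 2) ≡ 3 + (i * 2 + i * i) * 4
      odd*[odd+2]≡3[4] = ℕS.solve-∀

    odd*[odd+2]≢p*square : ∀ i c → (1 + i * 2) * (1 + i * 2 + 2) ≢ p * (c * c)
    odd*[odd+2]≢p*square i c eq with even⊎odd c
    ... | inj₁ (d , refl) with p*even²≡0[4] d
    ...   | a , pc²≡4a   = contradiction
      (residue-unique (i * 2 + i * i) a (ℕ.n<1+n 3) (s≤s z≤n)
                      (trans (sym (odd*[odd+2]≡3[4] i)) (trans eq pc²≡4a))) λ ()
    odd*[odd+2]≢p*square i c eq | inj₂ (d , refl) with p*odd²≡1[4] d
    ...   | a , pc²≡1+4a = contradiction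
      (residue-unique (i * 2 + i * i) a (ℕ.n<1+n 3) (s≤s (s≤s z≤n))
                      (trans (sym (odd*[odd+2]≡3[4] i)) (trans eq pc²≡1+4a))) λ ()

    square-halving : ∀ {u b} → u * 4 ≡ p * (b * b) → ∃[ c ] b ≡ c * 2 × u ≡ p * (c * c)
    square-halving {u} {b} 4u≡pb² with p*square-even {b} {u * 2} (trans (sym 4u≡pb²) (regroup u))
      where
      regroup : ∀ u → u * 4 ≡ u * 2 * 2
      regroup = ℕS.solve-∀
    ... | c , refl = c , refl , ℕ.*-cancelʳ-≡ u (p * (c * c)) 4 (trans 4u≡pb² (regroup p c))
      where
      regroup : ∀ p c → p * (c * 2 * (c * 2)) ≡ p * (c * c) * 4
      regroup = ℕS.solve-∀

    private
      *2-pos : ∀ {c} → 0 < c * 2 → 0 < c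
      *2-pos {suc _} _ = s≤s z≤n
      even-product : ∀ j → j * 2 * (j * 2 + 4) ≡ j * (j + 2) * 4
      even-product = ℕS.solve-∀
      even-product′ : ∀ i → i * 2 * (i * 2 + 2) ≡ i * (i + 1) * 4
      even-product′ = ℕS.solve-∀
      quadruple : ∀ i → i * 4 ≡ i * 2 * 2
      quadruple = ℕS.solve-∀
      quadruple+4 : ∀ i → (i + 1) * 4 ≡ i * 2 * 2 + 4
      quadruple+4 = ℕS.solve-∀

    -- For odd s the factors s and s + 4 are coprime. For even s the mod 4 obstruction forces
    -- s = 4i and b = 4c, and then i and i + 1 are coprime with product p c².
    descent : ∀ {s b} → 0 < b → s * (s + 4) ≡ p * (b * b) → ∃[ x ] ∃[ y ] y ≤ b × SquareSplit p s (s + 4) x y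
    descent {s} {b} 0<b eq with even⊎odd s
    ... | inj₂ (j , refl) = coprime-split p-prime (odd⊥odd+4 j) eq 0<b
    ... | inj₁ (j , refl) with square-halving {j * (j + 2)} {b} (trans (sym (even-product j)) eq)
    ...   | b₁ , refl , j[j+2]≡pb₁² with even⊎odd j
    ...     | inj₂ (i , refl) = contradiction j[j+2]≡pb₁² (odd*[odd+2]≢p*square i b₁)
    ...     | inj₁ (i , refl) with square-halving {i * (i + 1)} {b₁} (trans (sym (even-product′ i)) j[j+2]≡pb₁²)
    ...       | c , refl , i[i+1]≡pc²
                  with coprime-split p-prime {i} {i + 1} {c} (consecutive-coprime i) i[i+1]≡pc² (*2-pos (*2-pos 0<b))
    ...         | x , y , y≤c , split =
                  x * 2 , y * 2 , ℕ.≤-trans (ℕ.*-monoˡ-≤ 2 y≤c) (ℕ.m≤m*n (c * 2) 2) ,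
                  subst₂ (λ u v → SquareSplit p u v (x * 2) (y * 2)) (quadruple i) (quadruple+4 i) (SquareSplit-*4 split)

  prime≡1[4]⇒∤2 : ∀ {p} → Prime p → p % 4 ≡ 1 → ¬ p ∣ 2
  prime≡1[4]⇒∤2 {1} p-prime _  _   = ¬prime[1] p-prime
  prime≡1[4]⇒∤2 {suc (suc (suc _))} _ _ p∣2 = contradiction (ℕ.∣⇒≤ p∣2) λ { (s≤s (s≤s ())) }


module FundamentalUnitNorm where

  open import Data.Nat as ℕ using (ℕ; zero; suc; z≤n; s≤s; _%_)
  import Data.Nat.Properties as ℕ
  import Data.Nat.Tactic.RingSolver as ℕS
  open import Data.Nat.Primality using (Prime; prime⇒nonZero)
  open import Data.Integer as ℤ using (ℤ; +_; _+_; _-_; _*_; -[1+_]; 0ℤ; 1ℤ)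
  import Data.Integer.Properties as ℤ
  open import Data.Integer.Tactic.RingSolver using (solve-∀)
  open import Data.Product using (_×_; _,_)
  open import Data.Sum using (inj₁; inj₂)
  open import Relation.Binary.PropositionalEquality
    using (_≡_; _≢_; refl; sym; trans; cong; cong₂; subst; subst₂; module ≡-Reasoning)
  open import Relation.Nullary using (contradiction)
  open import Defs using (SqrtLt; IsUnit; IsFundamentalUnit)
  open Descent

  +[1+m+k]-+m : ∀ m k → + (suc m ℕ.+ k) - + m ≡ + suc k
  +[1+m+k]-+m m k = trans (cong (_- + m) (ℤ.pos-+ (suc m) k)) (cancel (+ m) (+ k))
    where
    cancel : ∀ m k → (1ℤ + m + k) - m ≡ 1ℤ + k
    cancel = solve-∀

  +m-+[1+m+k] : ∀ m k → + m - + (suc m ℕ.+ k) ≡ -[1+ k ]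
  +m-+[1+m+k] m k = trans (cong (+ m -_) (ℤ.pos-+ (suc m) k)) (cancel (+ m) (+ k))
    where
    cancel : ∀ m k → m - (1ℤ + m + k) ≡ ℤ.- (1ℤ + k)
    cancel = solve-∀

  SqrtLt-≤-< : ∀ p {x y t b} → y ℕ.≤ b → x ℕ.< t → SqrtLt p (+ y - + b) (+ t - + x)
  SqrtLt-≤-< p {x} {y} y≤b x<t with ℕ.m≤n⇒∃[o]m+o≡n x<t
  ... | k , refl with ℕ.m≤n⇒m<n∨m≡n y≤b
  ...   | inj₂ refl = inj₁ (ℤ.≤-reflexive (sym y-y≡0) ,
                            subst (0ℤ ℤ.<_) (sym t-x≡) (ℤ.+<+ (s≤s z≤n)) ,
                            subst₂ ℤ._<_ (sym p[y-y]²≡0) (sym (cong₂ _*_ t-x≡ t-x≡)) (ℤ.+<+ (s≤s z≤n)))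
    where
    t-x≡ = +[1+m+k]-+m x k
    y-y≡0 : + y - + y ≡ 0ℤ
    y-y≡0 = ℤ.+-inverseʳ (+ y)
    p[y-y]²≡0 : + p * (+ y - + y) * (+ y - + y) ≡ 0ℤ
    p[y-y]²≡0 = trans (cong (λ z → + p * z * z) y-y≡0) (ℤ.*-zeroʳ (+ p * 0ℤ))
  ...   | inj₁ y<b with ℕ.m≤n⇒∃[o]m+o≡n y<b
  ...     | j , refl = inj₂ (inj₁ (subst (ℤ._< 0ℤ) (sym (+m-+[1+m+k] y j)) ℤ.-<+ ,
                                   subst (0ℤ ℤ.≤_) (sym (+[1+m+k]-+m x k)) (ℤ.+≤+ z≤n)))

  +x*+x-+p*+y*+y : ∀ p x y → + x * + x - + p * + y * + y ≡ + (x ℕ.* x) - + (p ℕ.* (y ℕ.* y))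
  +x*+x-+p*+y*+y p x y = cong₂ _-_ (sym (ℤ.pos-* x x))
    (trans (cong (_* + y) (sym (ℤ.pos-* p y))) (trans (sym (ℤ.pos-* (p ℕ.* y) y)) (cong +_ (ℕ.*-assoc p y y))))

  SquareSplit⇒IsUnit : ∀ {p s x y} → SquareSplit p s (s ℕ.+ 4) x y → IsUnit p x y
  SquareSplit⇒IsUnit {p} {s} {x} {y} (first-square s≡x² s+4≡py²) = inj₂ (begin
    + x * + x - + p * + y * + y               ≡⟨ +x*+x-+p*+y*+y p x y ⟩
    + (x ℕ.* x) - + (p ℕ.* (y ℕ.* y))         ≡⟨ cong₂ (λ u v → + u - + v) s≡x² s+4≡py² ⟨
    + s - + (s ℕ.+ 4)                         ≡⟨ cong (+ s -_) (ℤ.pos-+ s 4) ⟩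
    + s - (+ s + + 4)                         ≡⟨ cancel (+ s) ⟩
    ℤ.- + 4                                   ∎)
    where
    open ≡-Reasoning
    cancel : ∀ s → s - (s + + 4) ≡ ℤ.- + 4
    cancel = solve-∀
  SquareSplit⇒IsUnit {p} {s} {x} {y} (second-square s≡py² s+4≡x²) = inj₁ (begin
    + x * + x - + p * + y * + y               ≡⟨ +x*+x-+p*+y*+y p x y ⟩
    + (x ℕ.* x) - + (p ℕ.* (y ℕ.* y))         ≡⟨ cong₂ (λ u v → + u - + v) s+4≡x² s≡py² ⟨
    + (s ℕ.+ 4) - + s                         ≡⟨ cong (_- + s) (ℤ.pos-+ s 4) ⟩
    (+ s + + 4) - + s                         ≡⟨ cancel (+ s) ⟩
    + 4                                       ∎)
    where
    open ≡-Reasoning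
    cancel : ∀ s → (s + + 4) - s ≡ + 4
    cancel = solve-∀

  private
    square-pos : ∀ {x n} → suc n ≡ x ℕ.* x → 0 ℕ.< x
    square-pos {suc _} _ = s≤s z≤n

    p*square-pos : ∀ {p y n} → suc n ≡ p ℕ.* (y ℕ.* y) → 0 ℕ.< y
    p*square-pos {p} {zero}  eq = contradiction (trans eq (ℕ.*-zeroʳ p)) λ ()
    p*square-pos {p} {suc _} _  = s≤s z≤n

  SquareSplit-bounds : ∀ {p s x y} → SquareSplit p (suc s) (suc s ℕ.+ 4) x y →
                       0 ℕ.< x × 0 ℕ.< y × x ℕ.* x ℕ.≤ suc s ℕ.+ 4
  SquareSplit-bounds {p} {s} (first-square s≡x² s+4≡py²) =
    square-pos s≡x² , p*square-pos {p} s+4≡py² , ℕ.≤-trans (ℕ.≤-reflexive (sym s≡x²)) (ℕ.m≤m+n (suc s) 4)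
  SquareSplit-bounds {p} (second-square s≡py² s+4≡x²) =
    square-pos s+4≡x² , p*square-pos {p} s≡py² , ℕ.≤-reflexive (sym s+4≡x²)

  module _ {p : ℕ} (p-prime : Prime p) (p≡1[4] : p % 4 ≡ 1) where

    fundamental-unit-norm≢1 : ∀ {t b} → IsFundamentalUnit p t b → t ℕ.* t ≢ p ℕ.* (b ℕ.* b) ℕ.+ 4
    fundamental-unit-norm≢1 {0} {b} _ eq = contradiction (trans eq (ℕ.+-comm _ 4)) λ ()
    fundamental-unit-norm≢1 {1} {b} _ eq = contradiction (trans eq (ℕ.+-comm _ 4)) λ ()
    fundamental-unit-norm≢1 {2} {suc b} _ eq =
      contradiction (ℕ.+-cancelʳ-≡ 4 0 (p ℕ.* (suc b ℕ.* suc b)) eq) (ℕ.<⇒≢ (ℕ.>-nonZero⁻¹ _))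
      where instance
        _ = prime⇒nonZero p-prime
        _ = ℕ.m*n≢0 p (suc b ℕ.* suc b)
    fundamental-unit-norm≢1 {suc (suc (suc s))} {b} (_ , 0<b , _ , minimal) eq
      with descent p-prime p≡1[4] 0<b (ℕ.+-cancelʳ-≡ 4 _ _ (trans (sym (expand s)) eq))
      where
      expand : ∀ s → (3 ℕ.+ s) ℕ.* (3 ℕ.+ s) ≡ suc s ℕ.* (suc s ℕ.+ 4) ℕ.+ 4
      expand = ℕS.solve-∀
    ... | x , y , y≤b , split with SquareSplit-bounds split
    ...   | 0<x , 0<y , x²≤s+4 = minimal x y 0<x 0<y (SquareSplit⇒IsUnit split) (SqrtLt-≤-< p y≤b x<t)
      where
      t = suc (suc (suc s))
      s+4<t² : suc s ℕ.+ 4 ℕ.< t ℕ.* t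
      s+4<t² = subst (suc s ℕ.+ 4 ℕ.<_) (sym (expand s)) (s≤s (ℕ.m≤m+n _ _))
        where
        expand : ∀ s → (3 ℕ.+ s) ℕ.* (3 ℕ.+ s) ≡ suc ((suc s ℕ.+ 4) ℕ.+ (s ℕ.* s ℕ.+ 5 ℕ.* s ℕ.+ 3))
        expand = ℕS.solve-∀
      x<t : x ℕ.< t
      x<t = ℕ.≰⇒> λ t≤x → ℕ.<⇒≱ s+4<t² (ℕ.≤-trans (ℕ.*-mono-≤ t≤x t≤x) x²≤s+4)

    fundamental-unit-norm : ∀ {t b} → IsFundamentalUnit p t b → + t * + t + + 4 ≡ + p * (+ b * + b)
    fundamental-unit-norm {t} {b} (_ , _ , inj₂ norm≡-4 , _) = begin
      + t * + t + + 4                                    ≡⟨ regroup (+ t * + t) (+ p * + b * + b) ⟩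
      (+ t * + t - + p * + b * + b) + + 4 + + p * + b * + b ≡⟨ cong (λ n → n + + 4 + + p * + b * + b) norm≡-4 ⟩
      ℤ.- + 4 + + 4 + + p * + b * + b                     ≡⟨ ℤ.+-identityˡ (+ p * + b * + b) ⟩
      + p * + b * + b                                    ≡⟨ ℤ.*-assoc (+ p) (+ b) (+ b) ⟩
      + p * (+ b * + b)                                  ∎
      where
      open ≡-Reasoning
      regroup : ∀ u v → u + + 4 ≡ (u - v) + + 4 + v
      regroup = solve-∀
    fundamental-unit-norm {t} {b} fu@(_ , _ , inj₁ norm≡4 , _) =
      contradiction (ℤ.+-injective (begin
        + (t ℕ.* t)                                        ≡⟨ regroup (+ (t ℕ.* t)) (+ (p ℕ.* (b ℕ.* b))) ⟩
        (+ (t ℕ.* t) - + (p ℕ.* (b ℕ.* b))) + + (p ℕ.* (b ℕ.* b))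
          ≡⟨ cong (_+ + (p ℕ.* (b ℕ.* b))) (trans (sym (+x*+x-+p*+y*+y p t b)) norm≡4) ⟩
        + 4 + + (p ℕ.* (b ℕ.* b))                          ≡⟨ ℤ.+-comm (+ 4) (+ (p ℕ.* (b ℕ.* b))) ⟩
        + (p ℕ.* (b ℕ.* b) ℕ.+ 4)                          ∎))
        (fundamental-unit-norm≢1 fu)
      where
      open ≡-Reasoning
      regroup : ∀ u v → u ≡ (u - v) + v
      regroup = solve-∀

open import Defs
open import Data.Nat using (ℕ; _*_; _∸_; _%_)
open import Data.Nat.Divisibility using (_∣_)
open import Data.Nat.Primality using (Prime)
open import Data.Integer using (+_)
open import Data.Product using (_×_; _,_)
open import Relation.Binary.PropositionalEquality using (_≡_; sym; trans; subst)
import Data.Nat.Properties as ℕ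
import Data.Integer as ℤ
import Data.Integer.Properties as ℤ
open import Data.Integer.Divisibility.Signed as Signed using (divides)
open Congruence using (Periodic; least-period-∣)
open LucasSequences using (module Lucas; module OddPrimeDivisor)
open Descent using (prime≡1[4]⇒∤2)
open FundamentalUnitNorm using (fundamental-unit-norm)

lemma3 : (p t b : ℕ) → Prime p → p % 4 ≡ 1 → IsFundamentalUnit p t b →
    (∀ k → IsLeastPeriodMod (p * p) (𝓕 (+ t)) k → k ∣ p * p * (p ∸ 1))
    × (∀ k → IsLeastPeriodMod (p * p) (𝓛 (+ t)) k → k ∣ p * (p ∸ 1))
lemma3 p t b p-prime p≡1[4] fu =
    (λ k k-least → subst (k ∣_) (sym (ℕ.*-assoc p p (p ∸ 1)))
                         (least-period-∣ k-least (mod-p² 𝓕-periodic)))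
  , (λ k k-least → least-period-∣ k-least (mod-p² 𝓛-periodic))
  where
  p∣D : + p Signed.∣ Lucas.D (+ t)
  p∣D = divides (+ b ℤ.* + b) (trans (fundamental-unit-norm p-prime p≡1[4] fu) (ℤ.*-comm (+ p) _))
  open OddPrimeDivisor p-prime (prime≡1[4]⇒∤2 p-prime p≡1[4]) t p∣D
  mod-p² : ∀ {f k} → Periodic (+ p ℤ.* + p) f k → Periodic (+ (p * p)) f k
  mod-p² = subst (λ m → Periodic m _ _) (sym (ℤ.pos-* p p))
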